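{- Let $W$ be a set of eight distinct MacMahon cubes such that $G_W$ has eight edges. If $G_W$ has exactly two connected components and neither of them is a tree, then the solution number of $W$ for the target $\mathrm{Ba}$ is $4$.
   Context: A MacMahon cube is a cube whose six faces are painted with the colors $1,\dots,6$, each used once, up to rotation (there are $30$ of them). At each vertex three faces meet; reading their colors clockwise as seen from outside gives a cyclic triple, and the corner number of the vertex is the cyclic rotation of this triple of smallest three-digit value; each MacMahon cube has $8$ distinct corner numbers. $\mathrm{Ba}$ denotes the MacMahon cube whose corner numbers are $\{123,134,146,162,253,265,354,456\}$. Every MacMahon cube other than $\mathrm{Ba}$ shares either $0$ or exactly $2$ corner numbers with $\mathrm{Ba}$. $M$ is the multigraph whose vertex set is the $8$ corner numbers of $\mathrm{Ba}$, with one edge, labeled $C$, joining the two shared corner numbers for each MacMahon cube $C\neq\mathrm{Ba}$ sharing exactly two corner numbers with $\mathrm{Ba}$ ($20$ edges, no loops, some parallel pairs). For a set $W$ of MacMahon cubes, $G_W$ is the subgraph of $M$ with all $8$ vertices and exactly the edges labeled by cubes in $W$. A solution for target $\mathrm{Ba}$ is a bijection $\sigma$ from $W$ to the corner numbers of $\mathrm{Ba}$ with $\sigma(C)$ a corner number of $C$ for all $C\in W$; the solution number is the number of such bijections. An isolated vertex counts as a tree component. -}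

module Defs where

open import Data.Nat using (ℕ; zero; suc; _+_; _*_; _⊓_)
open import Data.Fin using (Fin; zero; suc; toℕ; inject₁; fromℕ)
open import Data.Vec using (Vec; []; _∷_; lookup; tabulate)
open import Data.List using (List; []; _∷_)
open import Data.List.Membership.Propositional using (_∈_)
open import Data.Product using (Σ; ∃; ∃-syntax; _×_; _,_)
open import Data.Sum using (_⊎_)
open import Relation.Nullary using (¬_)
open import Relation.Binary.PropositionalEquality using (_≡_; _≢_)
open import Relation.Binary.Construct.Closure.ReflexiveTransitive using (Star)
open import Function.Definitions using (Injective; Surjective)
open import Function.Bundles using (_⇔_)

-- Faces (Fin 6): 0 = U (+z), 1 = D (-z), 2 = F (-y), 3 = B (+y),
--                4 = L (-x), 5 = R (+x).
-- A coloring assigns to each face a colour in Fin 6; colour k is the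
-- paper's colour k+1.  A MacMahon colouring uses every colour once.

Face : Set
Face = Fin 6

Colour : Set
Colour = Fin 6

Coloring : Set
Coloring = Vec Colour 6

ValidColoring : Coloring → Set
ValidColoring c = Injective _≡_ _≡_ (lookup c)

fU fD fF fB fL fR : Face
fU = zero
fD = suc zero
fF = suc (suc zero)
fB = suc (suc (suc zero))
fL = suc (suc (suc (suc zero)))
fR = suc (suc (suc (suc (suc zero))))

-- The 8 vertices, each given by its three faces listed clockwise as
-- seen from outside the cube (vertex (±x,±y,±z)).
vertexFaces : List (Face × Face × Face)
vertexFaces =
    (fR , fU , fB)
  ∷ (fL , fB , fU)
  ∷ (fR , fF , fU)
  ∷ (fR , fB , fD)
  ∷ (fL , fU , fF)
  ∷ (fL , fD , fB)
  ∷ (fR , fD , fF)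
  ∷ (fL , fF , fD)
  ∷ []

col : Colour → ℕ
col k = suc (toℕ k)

threeDigit : ℕ → ℕ → ℕ → ℕ
threeDigit a b c = 100 * a + 10 * b + c

cornerNumber : ℕ → ℕ → ℕ → ℕ
cornerNumber a b c = threeDigit a b c ⊓ threeDigit b c a ⊓ threeDigit c a b

mapV : List (Face × Face × Face) → Coloring → List ℕ
mapV [] c = []
mapV ((f , g , h) ∷ vs) c =
  cornerNumber (col (lookup c f)) (col (lookup c g)) (col (lookup c h)) ∷ mapV vs c

corners : Coloring → List ℕ
corners c = mapV vertexFaces c

-- Two colourings represent the same MacMahon cube iff one is
-- obtained from the other by a rotation of the cube.  The rotation group
-- is generated by the quarter turns about the z-axis and the x-axis.

-- quarter turn about z: F → R → B → L → F  (U, D fixed)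
permZ : Face → Face
permZ zero = fU
permZ (suc zero) = fD
permZ (suc (suc zero)) = fL
permZ (suc (suc (suc zero))) = fR
permZ (suc (suc (suc (suc zero)))) = fB
permZ (suc (suc (suc (suc (suc zero))))) = fF

-- quarter turn about x: U → F → D → B → U  (L, R fixed)
permX : Face → Face
permX zero = fB
permX (suc zero) = fF
permX (suc (suc zero)) = fU
permX (suc (suc (suc zero))) = fD
permX (suc (suc (suc (suc zero)))) = fL
permX (suc (suc (suc (suc (suc zero))))) = fR

-- new colour on face f is the old colour of the face that moved onto f
rotate : (Face → Face) → Coloring → Coloring
rotate π c = tabulate (λ f → lookup c (π f))

data RotStep : Coloring → Coloring → Set where
  turnZ : ∀ c → RotStep c (rotate permZ c)
  turnX : ∀ c → RotStep c (rotate permX c)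

SameCube : Coloring → Coloring → Set
SameCube = Star RotStep

-- The target cube Ba, given by its corner numbers; vertices of M are
-- indexed by Fin 8 through this list.

baCorner : Fin 8 → ℕ
baCorner i = lookup (123 ∷ 134 ∷ 146 ∷ 162 ∷ 253 ∷ 265 ∷ 354 ∷ 456 ∷ []) i

-- The cube c shares exactly the two corner numbers baCorner i and
-- baCorner j with Ba; i.e. c labels an edge of M joining i and j.
EdgeOf : Coloring → Fin 8 → Fin 8 → Set
EdgeOf c i j = i ≢ j × (∀ k → (baCorner k ∈ corners c) ⇔ (k ≡ i ⊎ k ≡ j))

LabelsEdge : Coloring → Set
LabelsEdge c = ∃[ i ] ∃[ j ] EdgeOf c i j

-- The graph G_W for W given as a family of 8 colourings (edges of G_W
-- are indexed by the elements e : Fin 8 of W that label an edge of M).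

Family : Set
Family = Fin 8 → Coloring

Adj : Family → Fin 8 → Fin 8 → Set
Adj W u v = ∃[ e ] EdgeOf (W e) u v

Connected : Family → Fin 8 → Fin 8 → Set
Connected W = Star (Adj W)

TwoComponents : Family → Set
TwoComponents W =
  ∃[ a ] ∃[ b ] (¬ Connected W a b × (∀ v → Connected W a v ⊎ Connected W b v))

-- A cycle of G_W of length k = 2 + n: vertices v₀,…,v_{k-1} pairwise
-- distinct (vs has v_k = v₀ appended), edges e₀,…,e_{k-1} pairwise
-- distinct elements of W, e_i joining v_i and v_{i+1}.
record Cycle (W : Family) : Set where
  field
    n     : ℕ
    vs    : Fin (suc (suc (suc n))) → Fin 8
    es    : Fin (suc (suc n)) → Fin 8
    closed : vs (fromℕ (suc (suc n))) ≡ vs zero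
    vsInj : ∀ i j → vs (inject₁ i) ≡ vs (inject₁ j) → i ≡ j
    esInj : Injective _≡_ _≡_ es
    joins : ∀ i → EdgeOf (W (es i)) (vs (inject₁ i)) (vs (suc i))

-- the connected component of G_W containing x is a tree (it is connected
-- by construction; a tree iff it contains no cycle)
ComponentIsTree : Family → Fin 8 → Set
ComponentIsTree W x =
  ¬ (Σ (Cycle W) λ C → ∀ i → Connected W x (Cycle.vs C i))

-- Solutions for target Ba: a bijection σ from W (indices Fin 8) to the
-- corner numbers of Ba (indices Fin 8) with σ(C) a corner number of C.

IsSolution : Family → Vec (Fin 8) 8 → Set
IsSolution W σ =
  (Injective _≡_ _≡_ (lookup σ) × Surjective _≡_ _≡_ (lookup σ))
  × (∀ e → baCorner (lookup σ e) ∈ corners (W e))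

data Distinct {A : Set} : {m : ℕ} → Vec A m → Set where
  []  : Distinct []
  _∷_ : ∀ {m x} {xs : Vec A m} →
        (∀ i → lookup xs i ≢ x) → Distinct xs → Distinct (x ∷ xs)

SolutionNumber : Family → ℕ → Set
SolutionNumber W m =
  Σ (Vec (Vec (Fin 8) 8) m) λ sols →
    Distinct sols
    × (∀ i → IsSolution W (lookup sols i))
    × (∀ σ → IsSolution W σ → ∃[ i ] lookup sols i ≡ σ)

-- A connected graph that is not a tree has at least as many edges as vertices, so with
-- eight edges on eight vertices each of the two components of G_W carries exactly one
-- cycle. A solution is the inverse of an injective choice τ of an incident edge at every
-- vertex. Such a τ sends the cycle vertices to cycle edges, where it is one of the two
-- orientations of each cycle, and it is forced elsewhere: by induction on the distance to
-- the cycles, every other vertex takes the first edge of a shortest path to its cycle.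
-- This gives 2 · 2 = 4 solutions. Formally, the edge count enters only through the fact
-- that an injective map from the eight vertices to the eight edges is a bijection.

{-# OPTIONS --safe #-}
module Submission where

open import Defs
open import Data.Empty using (⊥-elim)
open import Data.Fin using (Fin; zero; suc; toℕ; inject₁; fromℕ; punchOut; remQuot; combine)
open import Data.Fin.Induction using (<-weakInduction; >-weakInduction)
open import Data.Fin.Properties
  using (any?; all?; 0≢1+n; suc-injective; fromℕ≢inject₁; inject₁-injective; punchOut-injective;
         pigeonhole; injective⇒≤; remQuot-combine; combine-remQuot)
  renaming (_≟_ to _≟ᶠ_)
open import Data.List using (List; []; _∷_; [_]; filter; allFin; cartesianProductWith; length)
import Data.List as List
open import Data.List.Membership.Propositional using (_∈_)
open import Data.List.Membership.Propositional.Properties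
  using (∈-allFin; ∈-cartesianProductWith⁺; ∈-filter⁺; ∈-filter⁻; ∈-lookup)
open import Data.List.Relation.Unary.All as All using ([])
open import Data.List.Relation.Unary.AllPairs using ([]; _∷_)
open import Data.List.Relation.Unary.Any using (here; index)
open import Data.List.Relation.Unary.Any.Properties using (lookup-index)
open import Data.List.Relation.Unary.Unique.Propositional using (Unique)
open import Data.List.Relation.Unary.Unique.Propositional.Properties
  using (cartesianProductWith⁺; allFin⁺; filter⁺)
open import Data.Nat using (ℕ; zero; suc; _+_; _≤_; _<_; s≤s; z<s)
open import Data.Nat.GeneralisedArithmetic using (iterate)
open import Data.Nat.Induction using (<-wellFounded)
open import Data.Nat.Properties
  using (anyUpTo?; ≤-refl; ≤-antisym; ≮⇒≥; <-asym; +-comm; n<1+n; 1+n≰n; m≤n⇒∃[o]m+o≡n)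
  renaming (_≟_ to _≟ℕ_)
open import Data.List.Membership.DecPropositional _≟ℕ_ using (_∈?_)
open import Data.Product using (Σ; ∃-syntax; _×_; _,_; proj₁; proj₂; uncurry)
open import Data.Sum using (_⊎_; inj₁; inj₂; swap; [_,_]′)
open import Data.Vec using (Vec; []; _∷_; lookup; tabulate)
open import Data.Vec.Properties using (∷-injective; lookup∘tabulate; tabulate∘lookup; tabulate-cong)
open import Function using (_∘_)
open import Function.Bundles using (Equivalence; mk⇔)
open import Function.Consequences.Propositional
  using (strictlySurjective⇒surjective; surjective⇒strictlySurjective)
open import Function.Definitions using (Injective; Surjective)
open import Induction.WellFounded using (Acc; acc)
open import Relation.Binary.Construct.Closure.ReflexiveTransitive using (ε; _◅_; _◅◅_; reverse)
open import Relation.Binary.PropositionalEquality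
  using (_≡_; _≢_; refl; sym; trans; cong; cong₂; subst; module ≡-Reasoning)
open import Relation.Nullary using (¬_; Dec; yes; no; ¬?)
open import Relation.Nullary.Decidable
  using (map′; decidable-stable; toSum; _×-dec_; _⊎-dec_; _→-dec_)
open import Relation.Unary using (Decidable)

-- Injective endomaps of finite sets

injective⇒surjective : ∀ {n} {f : Fin n → Fin n} → Injective _≡_ _≡_ f → ∀ y → ∃[ x ] f x ≡ y
injective⇒surjective {suc n} {f} f-inj y with any? (λ x → f x ≟ᶠ y)
... | yes found = found
... | no missed = ⊥-elim (1+n≰n (injective⇒≤ punchOut∘f-injective))
  where
  y≢f : ∀ x → y ≢ f x
  y≢f x eq = missed (x , sym eq)
  punchOut∘f-injective : Injective _≡_ _≡_ (λ x → punchOut (y≢f x))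
  punchOut∘f-injective eq = f-inj (punchOut-injective (y≢f _) (y≢f _) eq)

module _ {n} {f : Fin n → Fin n} (f-inj : Injective _≡_ _≡_ f) where

  iterate-+ : ∀ x a b → iterate f x (a + b) ≡ iterate f (iterate f x a) b
  iterate-+ x zero    b = refl
  iterate-+ x (suc a) b = iterate-+ (f x) a b

  iterate-cancel : ∀ a {x y} → iterate f x a ≡ iterate f y a → x ≡ y
  iterate-cancel zero    eq = eq
  iterate-cancel (suc a) eq = f-inj (iterate-cancel a eq)

  orbit-returns : ∀ x → ∃[ k ] iterate f (f x) k ≡ x
  orbit-returns x with i , j , i<j , xᵢ≡xⱼ ← pigeonhole (n<1+n n) (λ i → iterate f x (toℕ i))
            with k , 1+i+k≡j ← m≤n⇒∃[o]m+o≡n i<j = k , sym (iterate-cancel (toℕ i) (begin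
    iterate f x (toℕ i)                    ≡⟨ xᵢ≡xⱼ ⟩
    iterate f x (toℕ j)                    ≡⟨ cong (iterate f x) j≡1+k+i ⟩
    iterate f x (suc k + toℕ i)            ≡⟨ iterate-+ x (suc k) (toℕ i) ⟩
    iterate f (iterate f (f x) k) (toℕ i)  ∎))
    where
    open ≡-Reasoning
    j≡1+k+i : toℕ j ≡ suc k + toℕ i
    j≡1+k+i = trans (sym 1+i+k≡j) (cong suc (+-comm (toℕ i) k))

  preserves⇒reflects : (P : Fin n → Set) → (∀ {x} → P x → P (f x)) → ∀ {x} → P (f x) → P x
  preserves⇒reflects P forward {x} P[fx] with k , fᵏ⁺¹x≡x ← orbit-returns x =
    subst P fᵏ⁺¹x≡x (along k P[fx])
    where
    along : ∀ k {y} → P y → P (iterate f y k)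
    along zero    Py = Py
    along (suc k) Py = along k (forward Py)

prev : ∀ {m} → Fin (suc m) → Fin (suc m)
prev zero    = fromℕ _
prev (suc i) = inject₁ i

prev-injective : ∀ {m} → Injective _≡_ _≡_ (prev {m})
prev-injective {x = zero}  {zero}  _  = refl
prev-injective {x = zero}  {suc j} eq = ⊥-elim (fromℕ≢inject₁ eq)
prev-injective {x = suc i} {zero}  eq = ⊥-elim (fromℕ≢inject₁ (sym eq))
prev-injective {x = suc i} {suc j} eq = cong suc (inject₁-injective eq)

suc≢inject₁ : ∀ {m} (i : Fin m) → suc i ≢ inject₁ i
suc≢inject₁ zero    ()
suc≢inject₁ (suc i) eq = suc≢inject₁ i (suc-injective eq)

-- With edge i of a cycle joining its vertices i and i + 1, orient 0 gives every vertex
-- its outgoing edge and orient 1 its incoming edge.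
orient : ∀ {m} → Fin 2 → Fin (suc m) → Fin (suc m)
orient zero       i = i
orient (suc zero) i = prev i

orient-injective : ∀ {m} s → Injective _≡_ _≡_ (orient {m} s)
orient-injective zero       eq = eq
orient-injective (suc zero) eq = prev-injective eq

module _ {m} {t : Fin (suc (suc m)) → Fin (suc (suc m))} (t-inj : Injective _≡_ _≡_ t)
         (t-near : ∀ i → t i ≡ i ⊎ t i ≡ prev i) where

  private
    fixed-spreads : ∀ i → t (inject₁ i) ≡ inject₁ i → t (suc i) ≡ suc i
    fixed-spreads i fixed with t-near (suc i)
    ... | inj₁ eq = eq
    ... | inj₂ eq = ⊥-elim (suc≢inject₁ i (t-inj (trans eq (sym fixed))))

    shifted-spreads : ∀ i → t (suc i) ≡ prev (suc i) → t (inject₁ i) ≡ prev (inject₁ i)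
    shifted-spreads i shifted with t-near (inject₁ i)
    ... | inj₁ eq = ⊥-elim (suc≢inject₁ i (t-inj (trans shifted (sym eq))))
    ... | inj₂ eq = eq

    shifted-wraps : t zero ≡ prev zero → t (fromℕ _) ≡ prev (fromℕ _)
    shifted-wraps shifted with t-near (fromℕ _)
    ... | inj₁ eq = ⊥-elim (0≢1+n (t-inj (trans shifted (sym eq))))
    ... | inj₂ eq = eq

  injective-near⇒orient : ∃[ s ] ∀ i → t i ≡ orient s i
  injective-near⇒orient with t-near zero
  ... | inj₁ eq = zero , <-weakInduction (λ i → t i ≡ i) eq fixed-spreads
  ... | inj₂ eq = suc zero , >-weakInduction (λ i → t i ≡ prev i) (shifted-wraps eq) shifted-spreads

module _ {n} {τ : Fin n → Fin n} (τ-inj : Injective _≡_ _≡_ τ) where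

  opaque
    inverse : Vec (Fin n) n
    inverse = tabulate (λ e → proj₁ (injective⇒surjective τ-inj e))

    inverseˡ : ∀ e → τ (lookup inverse e) ≡ e
    inverseˡ e = trans (cong τ (lookup∘tabulate _ e)) (proj₂ (injective⇒surjective τ-inj e))

  inverseʳ : ∀ v → lookup inverse (τ v) ≡ v
  inverseʳ v = τ-inj (inverseˡ (τ v))

  inverse-unique : ∀ {σ} → (∀ e → τ (lookup σ e) ≡ e) → σ ≡ inverse
  inverse-unique {σ} τσ≗id = begin
    σ                          ≡⟨ tabulate∘lookup σ ⟨
    tabulate (lookup σ)        ≡⟨ tabulate-cong (λ e → τ-inj (trans (τσ≗id e) (sym (inverseˡ e)))) ⟩
    tabulate (lookup inverse)  ≡⟨ tabulate∘lookup inverse ⟩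
    inverse                    ∎
    where open ≡-Reasoning

inverse-injective : ∀ {n} {τ τ′ : Fin n → Fin n}
                    (τ-inj : Injective _≡_ _≡_ τ) (τ′-inj : Injective _≡_ _≡_ τ′) →
                    inverse τ-inj ≡ inverse τ′-inj → ∀ v → τ v ≡ τ′ v
inverse-injective {τ = τ} {τ′} τ-inj τ′-inj eq v = begin
  τ v                                 ≡⟨ inverseˡ τ′-inj (τ v) ⟨
  τ′ (lookup (inverse τ′-inj) (τ v))  ≡⟨ cong (λ σ → τ′ (lookup σ (τ v))) eq ⟨
  τ′ (lookup (inverse τ-inj) (τ v))   ≡⟨ cong τ′ (inverseʳ τ-inj v) ⟩
  τ′ v                                ∎
  where open ≡-Reasoning

injective? : ∀ {m n} (f : Fin m → Fin n) → Dec (Injective _≡_ _≡_ f)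
injective? f = map′ (λ inj → inj _ _) (λ inj _ _ → inj)
  (all? λ x → all? λ y → (f x ≟ᶠ f y) →-dec (x ≟ᶠ y))

surjective? : ∀ {m n} (f : Fin m → Fin n) → Dec (Surjective _≡_ _≡_ f)
surjective? f = map′ strictlySurjective⇒surjective surjective⇒strictlySurjective
  (all? λ y → any? λ x → f x ≟ᶠ y)

-- Counting

least-witness : ∀ {P : ℕ → Set} → Decidable P → ∀ {n} → P n → ∃[ m ] P m × (∀ {k} → k < m → ¬ P k)
least-witness {P} P? = go (<-wellFounded _)
  where
  go : ∀ {n} → Acc _<_ n → P n → ∃[ m ] P m × (∀ {k} → k < m → ¬ P k)
  go {n} (acc smaller) Pn with anyUpTo? P? n
  ... | yes (k , k<n , Pk) = go (smaller k<n) Pk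
  ... | no none            = n , Pn , λ k<n Pk → none (_ , k<n , Pk)

-- SolutionNumber W m is Count (IsSolution W) m.
Count : {A : Set} → (A → Set) → ℕ → Set
Count {A} P m =
  Σ (Vec A m) λ xs →
    Distinct xs × (∀ i → P (lookup xs i)) × (∀ x → P x → ∃[ i ] lookup xs i ≡ x)

distinct⇒injective : ∀ {A : Set} {m} {xs : Vec A m} → Distinct xs → Injective _≡_ _≡_ (lookup xs)
distinct⇒injective (_ ∷ _)        {zero}  {zero}  _  = refl
distinct⇒injective (x∉xs ∷ _)     {zero}  {suc j} eq = ⊥-elim (x∉xs j (sym eq))
distinct⇒injective (x∉xs ∷ _)     {suc i} {zero}  eq = ⊥-elim (x∉xs i eq)
distinct⇒injective (_ ∷ distinct) {suc i} {suc j} eq = cong suc (distinct⇒injective distinct eq)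

injective⇒distinct : ∀ {A : Set} {m} {f : Fin m → A} → Injective _≡_ _≡_ f → Distinct (tabulate f)
injective⇒distinct {m = zero}      _     = []
injective⇒distinct {m = suc m} {f} f-inj =
  (λ i eq → 0≢1+n (f-inj (trans (sym eq) (lookup∘tabulate (f ∘ suc) i))))
  ∷ injective⇒distinct (suc-injective ∘ f-inj)

count-image : ∀ {A : Set} {P : A → Set} {m} (f : Fin m → A) → Injective _≡_ _≡_ f →
              (∀ i → P (f i)) → (∀ x → P x → ∃[ i ] f i ≡ x) → Count P m
count-image {P = P} f f-inj sound complete =
  tabulate f , injective⇒distinct f-inj ,
  (λ i → subst P (sym (lookup∘tabulate f i)) (sound i)) ,
  λ x Px → let i , fi≡x = complete x Px in i , trans (lookup∘tabulate f i) fi≡x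

count-≤ : ∀ {A : Set} {P : A → Set} {m n} → Count P m → Count P n → m ≤ n
count-≤ {m = m} {n} (xs , xs-distinct , xs-sound , _) (ys , _ , _ , ys-complete) =
  injective⇒≤ position-injective
  where
  position : Fin m → Fin n
  position i = proj₁ (ys-complete (lookup xs i) (xs-sound i))

  position-injective : Injective _≡_ _≡_ position
  position-injective {i} {j} eq = distinct⇒injective xs-distinct (begin
    lookup xs i             ≡⟨ proj₂ (ys-complete _ (xs-sound i)) ⟨
    lookup ys (position i)  ≡⟨ cong (lookup ys) eq ⟩
    lookup ys (position j)  ≡⟨ proj₂ (ys-complete _ (xs-sound j)) ⟩
    lookup xs j             ∎)
    where open ≡-Reasoning

count-unique : ∀ {A : Set} {P : A → Set} {m n} → Count P m → Count P n → m ≡ n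
count-unique c d = ≤-antisym (count-≤ c d) (count-≤ d c)

unique⇒lookup-injective : ∀ {A : Set} {xs : List A} → Unique xs → Injective _≡_ _≡_ (List.lookup xs)
unique⇒lookup-injective (_ ∷ _)      {zero}  {zero}  _  = refl
unique⇒lookup-injective (x∉xs ∷ _)   {zero}  {suc j} eq = ⊥-elim (All.lookup x∉xs (∈-lookup j) eq)
unique⇒lookup-injective (x∉xs ∷ _)   {suc i} {zero}  eq = ⊥-elim (All.lookup x∉xs (∈-lookup i) (sym eq))
unique⇒lookup-injective (_ ∷ unique) {suc i} {suc j} eq = cong suc (unique⇒lookup-injective unique eq)

module _ {A : Set} {xs : List A} (xs-unique : Unique xs) (xs-complete : ∀ x → x ∈ xs)
         {P : A → Set} (P? : Decidable P) where

  count : ∃[ m ] Count P m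
  count = length ys , count-image (List.lookup ys) (unique⇒lookup-injective (filter⁺ P? xs-unique))
    (λ i → proj₂ (∈-filter⁻ P? {xs = xs} (∈-lookup i)))
    (λ x Px → let x∈ys = ∈-filter⁺ P? (xs-complete x) Px in index x∈ys , sym (lookup-index x∈ys))
    where ys = filter P? xs

  count-stable : ∀ {m} → ¬ ¬ Count P m → Count P m
  count-stable {m} ¬¬count with m′ , count′ ← count =
    subst (Count P) (decidable-stable (m′ ≟ℕ m) λ m′≢m → ¬¬count (m′≢m ∘ count-unique count′))
      count′

allVecs : ∀ k n → List (Vec (Fin k) n)
allVecs k zero    = [ [] ]
allVecs k (suc n) = cartesianProductWith _∷_ (allFin k) (allVecs k n)

allVecs-unique : ∀ k n → Unique (allVecs k n)
allVecs-unique k zero    = [] ∷ []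
allVecs-unique k (suc n) = cartesianProductWith⁺ _∷_ ∷-injective (allFin⁺ k) (allVecs-unique k n)

∈-allVecs : ∀ {k n} (v : Vec (Fin k) n) → v ∈ allVecs k n
∈-allVecs []      = here refl
∈-allVecs (x ∷ v) = ∈-cartesianProductWith⁺ _∷_ (∈-allFin x) (∈-allVecs v)

-- The graph G_W

one-of-two : ∀ {A : Set} {a b x y z : A} → x ≡ a ⊎ x ≡ b → y ≡ a ⊎ y ≡ b → x ≢ y →
             z ≡ a ⊎ z ≡ b → z ≡ x ⊎ z ≡ y
one-of-two (inj₁ refl) (inj₁ refl) x≢y _  = ⊥-elim (x≢y refl)
one-of-two (inj₂ refl) (inj₂ refl) x≢y _  = ⊥-elim (x≢y refl)
one-of-two (inj₁ refl) (inj₂ refl) _   z∈ = z∈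
one-of-two (inj₂ refl) (inj₁ refl) _   z∈ = swap z∈

module Incidence (W : Family) where

  record Incident (e v : Fin 8) : Set where
    constructor incident
    field corner : baCorner v ∈ corners (W e)

  incident? : ∀ e v → Dec (Incident e v)
  incident? e v = map′ incident Incident.corner (baCorner v ∈? corners (W e))

  edge-incidentˡ : ∀ {e x y} → EdgeOf (W e) x y → Incident e x
  edge-incidentˡ {x = x} (_ , ends) = incident (Equivalence.from (ends x) (inj₁ refl))

  edge-incidentʳ : ∀ {e x y} → EdgeOf (W e) x y → Incident e y
  edge-incidentʳ {y = y} (_ , ends) = incident (Equivalence.from (ends y) (inj₂ refl))

  edge-ends : ∀ {e x y z} → EdgeOf (W e) x y → Incident e z → z ≡ x ⊎ z ≡ y
  edge-ends {z = z} (_ , ends) (incident corner) = Equivalence.to (ends z) corner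

  at-most-two-ends : ∀ {e x y z} → LabelsEdge (W e) → Incident e x → Incident e y → x ≢ y →
                     Incident e z → z ≡ x ⊎ z ≡ y
  at-most-two-ends (_ , _ , edge) x∈e y∈e x≢y z∈e =
    one-of-two (edge-ends edge x∈e) (edge-ends edge y∈e) x≢y (edge-ends edge z∈e)

  connected-sym : ∀ {u v} → Connected W u v → Connected W v u
  connected-sym = reverse λ (e , u≢v , ends) →
    e , u≢v ∘ sym , λ k → mk⇔ (swap ∘ Equivalence.to (ends k)) (Equivalence.from (ends k) ∘ swap)

  isSolution? : ∀ σ → Dec (IsSolution W σ)
  isSolution? σ = (injective? (lookup σ) ×-dec surjective? (lookup σ))
                  ×-dec all? (λ e → baCorner (lookup σ e) ∈? corners (W e))

  Choice : (Fin 8 → Fin 8) → Set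
  Choice τ = Injective _≡_ _≡_ τ × (∀ v → Incident (τ v) v)

  choice⇒solution : ∀ {τ} (choice : Choice τ) → IsSolution W (inverse (proj₁ choice))
  choice⇒solution {τ} (τ-inj , τ-incident) =
    ( (λ eq → trans (sym (inverseˡ τ-inj _)) (trans (cong τ eq) (inverseˡ τ-inj _)))
    , strictlySurjective⇒surjective (λ v → τ v , inverseʳ τ-inj v) )
    , λ e → Incident.corner
        (subst (λ e′ → Incident e′ (lookup (inverse τ-inj) e)) (inverseˡ τ-inj e) (τ-incident _))

  solution⇒choice : ∀ σ → IsSolution W σ → ∃[ τ ] Choice τ × (∀ e → τ (lookup σ e) ≡ e)
  solution⇒choice σ ((σ-inj , σ-surj) , σ-corner) = τ , (τ-inj , τ-incident) , τσ≗id
    where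
    τ : Fin 8 → Fin 8
    τ v = proj₁ (σ-surj v)
    στ≗id : ∀ v → lookup σ (τ v) ≡ v
    στ≗id v = proj₂ (σ-surj v) refl
    τ-inj : Injective _≡_ _≡_ τ
    τ-inj {v} {w} eq = trans (sym (στ≗id v)) (trans (cong (lookup σ) eq) (στ≗id w))
    τ-incident : ∀ v → Incident (τ v) v
    τ-incident v =
      incident (subst (λ u → baCorner u ∈ corners (W (τ v))) (στ≗id v) (σ-corner (τ v)))
    τσ≗id : ∀ e → τ (lookup σ e) ≡ e
    τσ≗id e = σ-inj (στ≗id (lookup σ e))

  module OnCycle (C : Cycle W) where
    open Cycle C public

    vertex : Fin (suc (suc n)) → Fin 8
    vertex i = vs (inject₁ i)

    vertex-injective : Injective _≡_ _≡_ vertex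
    vertex-injective = vsInj _ _

    next-vertex : ∀ i → vs (suc (prev i)) ≡ vertex i
    next-vertex zero    = closed
    next-vertex (suc i) = refl

    cycle-edge-ends : ∀ {j x} → Incident (es j) x → ∃[ i ] vertex i ≡ x
    cycle-edge-ends {j} x∈e with edge-ends (joins j) x∈e
    ... | inj₁ x≡ = j , sym x≡
    ... | inj₂ x≡ with i , refl ← injective⇒surjective prev-injective j =
      i , trans (sym (next-vertex i)) (sym x≡)

    cycle-edges-at : ∀ {i j} → Incident (es j) (vertex i) → j ≡ i ⊎ j ≡ prev i
    cycle-edges-at {i} {j} vᵢ∈e with edge-ends (joins j) vᵢ∈e
    ... | inj₁ vᵢ≡ = inj₁ (sym (vertex-injective vᵢ≡))
    ... | inj₂ vᵢ≡ with k , refl ← injective⇒surjective prev-injective j =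
      inj₂ (cong prev (sym (vertex-injective (trans vᵢ≡ (next-vertex k)))))

    incident-orient : ∀ s i → Incident (es (orient s i)) (vertex i)
    incident-orient zero       i = edge-incidentˡ (joins i)
    incident-orient (suc zero) i =
      subst (Incident (es (prev i))) (next-vertex i) (edge-incidentʳ (joins (prev i)))

    orient-determined : ∀ {s s′} → es (orient s zero) ≡ es (orient s′ zero) → s ≡ s′
    orient-determined {zero}     {zero}     _  = refl
    orient-determined {zero}     {suc zero} eq = ⊥-elim (0≢1+n (esInj eq))
    orient-determined {suc zero} {zero}     eq = ⊥-elim (0≢1+n (sym (esInj eq)))
    orient-determined {suc zero} {suc zero} _  = refl

    choice-on-cycle : ∀ {τ} → Choice τ → (∀ i → ∃[ j ] es j ≡ τ (vertex i)) →
                      ∃[ s ] ∀ i → τ (vertex i) ≡ es (orient s i)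
    choice-on-cycle {τ} (τ-inj , τ-incident) stays =
      let s , t≗orient = injective-near⇒orient t-inj t-near
      in s , λ i → trans (sym (proj₂ (stays i))) (cong es (t≗orient i))
      where
      t : Fin (suc (suc n)) → Fin (suc (suc n))
      t i = proj₁ (stays i)
      t-inj : Injective _≡_ _≡_ t
      t-inj {i} {j} eq =
        vertex-injective (τ-inj (trans (sym (proj₂ (stays i))) (trans (cong es eq) (proj₂ (stays j)))))
      t-near : ∀ i → t i ≡ i ⊎ t i ≡ prev i
      t-near i =
        cycle-edges-at (subst (λ e → Incident e (vertex i)) (sym (proj₂ (stays i))) (τ-incident (vertex i)))

-- Two components, each containing a cycle

module TwoCycles (W : Family) (labels : ∀ e → LabelsEdge (W e))
  (a b : Fin 8) (a≁b : ¬ Connected W a b) (cover : ∀ v → Connected W a v ⊎ Connected W b v)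
  (C₁ : Cycle W) (C₁∼a : ∀ i → Connected W a (Cycle.vs C₁ i))
  (C₂ : Cycle W) (C₂∼b : ∀ i → Connected W b (Cycle.vs C₂ i)) where

  open Incidence W
  module C₁ = OnCycle C₁
  module C₂ = OnCycle C₂

  cycles-disjoint : ∀ i j → C₁.vertex i ≢ C₂.vertex j
  cycles-disjoint i j eq =
    a≁b (C₁∼a (inject₁ i) ◅◅ subst (λ v → Connected W v b) (sym eq) (connected-sym (C₂∼b (inject₁ j))))

  OnCycles : Fin 8 → Set
  OnCycles v = (∃[ i ] C₁.vertex i ≡ v) ⊎ (∃[ j ] C₂.vertex j ≡ v)

  onCycles? : Decidable OnCycles
  onCycles? v = any? (λ i → C₁.vertex i ≟ᶠ v) ⊎-dec any? (λ j → C₂.vertex j ≟ᶠ v)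

  CycleEdge : Fin 8 → Set
  CycleEdge e = (∃[ i ] C₁.es i ≡ e) ⊎ (∃[ j ] C₂.es j ≡ e)

  cycle-edge-ends : ∀ {e x} → CycleEdge e → Incident e x → OnCycles x
  cycle-edge-ends (inj₁ (_ , refl)) x∈e = inj₁ (C₁.cycle-edge-ends x∈e)
  cycle-edge-ends (inj₂ (_ , refl)) x∈e = inj₂ (C₂.cycle-edge-ends x∈e)

  C₂-edge-misses-C₁ : ∀ {i j} → ¬ Incident (C₂.es j) (C₁.vertex i)
  C₂-edge-misses-C₁ {i} v∈e = let j′ , eq = C₂.cycle-edge-ends v∈e in cycles-disjoint i j′ (sym eq)

  C₁-edge-misses-C₂ : ∀ {i j} → ¬ Incident (C₁.es i) (C₂.vertex j)
  C₁-edge-misses-C₂ {j = j} v∈e = let i′ , eq = C₁.cycle-edge-ends v∈e in cycles-disjoint i′ j eq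

  cycle-edges-disjoint : ∀ i j → C₁.es i ≢ C₂.es j
  cycle-edges-disjoint i j eq =
    C₂-edge-misses-C₁ (subst (λ e → Incident e (C₁.vertex i)) eq (C₁.incident-orient zero i))

  Near : ℕ → Fin 8 → Set
  Near zero    v = OnCycles v
  Near (suc t) v = Near t v ⊎ ∃[ e ] ∃[ w ] Incident e v × Incident e w × w ≢ v × Near t w

  near? : ∀ t → Decidable (Near t)
  near? zero    v = onCycles? v
  near? (suc t) v = near? t v ⊎-dec
    any? λ e → any? λ w → incident? e v ×-dec incident? e w ×-dec ¬? (w ≟ᶠ v) ×-dec near? t w

  near-along : ∀ {x y t} → Connected W x y → Near t x → ∃[ t′ ] Near t′ y
  near-along {t = t} ε                   near = t , near
  near-along {t = t} ((e , edge) ◅ path) near = near-along {t = suc t} path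
    (inj₂ (e , _ , edge-incidentʳ edge , edge-incidentˡ edge , proj₁ edge , near))

  near-via-C₁ : ∀ {v} → Connected W a v → ∃[ t ] Near t v
  near-via-C₁ a∼v = near-along {t = 0} (connected-sym (C₁∼a zero) ◅◅ a∼v) (inj₁ (zero , refl))

  near-via-C₂ : ∀ {v} → Connected W b v → ∃[ t ] Near t v
  near-via-C₂ b∼v = near-along {t = 0} (connected-sym (C₂∼b zero) ◅◅ b∼v) (inj₂ (zero , refl))

  opaque
    nearest : ∀ v → ∃[ t ] Near t v × (∀ {k} → k < t → ¬ Near k v)
    nearest v = least-witness (λ t → near? t v) (proj₂ ([ near-via-C₁ , near-via-C₂ ]′ (cover v)))

  depth : Fin 8 → ℕ
  depth v = proj₁ (nearest v)

  depth-minimal : ∀ {t v} → Near t v → depth v ≤ t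
  depth-minimal {v = v} near = ≮⇒≥ λ t<depth → proj₂ (proj₂ (nearest v)) t<depth near

  record Parent (v : Fin 8) : Set where
    field
      edge            : Fin 8
      parent          : Fin 8
      incident-child  : Incident edge v
      incident-parent : Incident edge parent
      parent≢child    : parent ≢ v
      closer          : depth parent < depth v

  classify : ∀ v → OnCycles v ⊎ (¬ OnCycles v × Parent v)
  classify v with nearest v in eq
  ... | zero  , near₀ , _ = inj₁ near₀
  ... | suc t , inj₁ nearₜ , minimal = ⊥-elim (minimal ≤-refl nearₜ)
  ... | suc t , inj₂ (e , w , v∈e , w∈e , w≢v , nearₜ) , minimal =
    inj₂ (minimal z<s , record
      { edge = e ; parent = w ; incident-child = v∈e ; incident-parent = w∈e ; parent≢child = w≢v
      ; closer = subst (depth w <_) (sym (cong proj₁ eq)) (s≤s (depth-minimal nearₜ)) })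

  parent-edge-injective : ∀ {v w} (p : Parent v) (q : Parent w) → Parent.edge p ≡ Parent.edge q → v ≡ w
  parent-edge-injective {v} {w} p q refl
    with at-most-two-ends (labels (Parent.edge p)) (Parent.incident-child p) (Parent.incident-parent p)
           (Parent.parent≢child p ∘ sym) (Parent.incident-child q)
  ... | inj₁ w≡v = sym w≡v
  ... | inj₂ refl
    with at-most-two-ends (labels (Parent.edge p)) (Parent.incident-child p) (Parent.incident-parent p)
           (Parent.parent≢child p ∘ sym) (Parent.incident-parent q)
  ... | inj₁ refl = ⊥-elim (<-asym (Parent.closer p) (Parent.closer q))
  ... | inj₂ p≡q = ⊥-elim (Parent.parent≢child q p≡q)

  off-cycles-edge : ∀ {v} → ¬ OnCycles v → (p : Parent v) → ¬ CycleEdge (Parent.edge p)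
  off-cycles-edge v∉ p cycle-edge = v∉ (cycle-edge-ends cycle-edge (Parent.incident-child p))

  Orientation : Set
  Orientation = Fin 2 × Fin 2

  pick : Orientation → ∀ v → OnCycles v ⊎ (¬ OnCycles v × Parent v) → Fin 8
  pick (s₁ , _) v (inj₁ (inj₁ (i , _))) = C₁.es (orient s₁ i)
  pick (_ , s₂) v (inj₁ (inj₂ (j , _))) = C₂.es (orient s₂ j)
  pick o        v (inj₂ (_ , p))        = Parent.edge p

  canonical : Orientation → Fin 8 → Fin 8
  canonical o v = pick o v (classify v)

  canonical-incident : ∀ o v → Incident (canonical o v) v
  canonical-incident o v with classify v
  ... | inj₁ (inj₁ (i , refl)) = C₁.incident-orient (proj₁ o) i
  ... | inj₁ (inj₂ (j , refl)) = C₂.incident-orient (proj₂ o) j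
  ... | inj₂ (_ , p)           = Parent.incident-child p

  canonical-C₁ : ∀ o i → canonical o (C₁.vertex i) ≡ C₁.es (orient (proj₁ o) i)
  canonical-C₁ o i with classify (C₁.vertex i)
  ... | inj₁ (inj₁ (i′ , eq)) = cong (C₁.es ∘ orient (proj₁ o)) (C₁.vertex-injective eq)
  ... | inj₁ (inj₂ (j , eq))  = ⊥-elim (cycles-disjoint i j (sym eq))
  ... | inj₂ (v∉ , _)         = ⊥-elim (v∉ (inj₁ (i , refl)))

  canonical-C₂ : ∀ o j → canonical o (C₂.vertex j) ≡ C₂.es (orient (proj₂ o) j)
  canonical-C₂ o j with classify (C₂.vertex j)
  ... | inj₁ (inj₁ (i , eq))  = ⊥-elim (cycles-disjoint i j eq)
  ... | inj₁ (inj₂ (j′ , eq)) = cong (C₂.es ∘ orient (proj₂ o)) (C₂.vertex-injective eq)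
  ... | inj₂ (v∉ , _)         = ⊥-elim (v∉ (inj₂ (j , refl)))

  canonical-cycle-edge : ∀ o {v} → OnCycles v → CycleEdge (canonical o v)
  canonical-cycle-edge o {v} v∈ with classify v
  ... | inj₁ (inj₁ (i , _)) = inj₁ (_ , refl)
  ... | inj₁ (inj₂ (j , _)) = inj₂ (_ , refl)
  ... | inj₂ (v∉ , _)       = ⊥-elim (v∉ v∈)

  canonical-off-cycles : ∀ o {v} → ¬ OnCycles v → Σ (Parent v) λ p → canonical o v ≡ Parent.edge p
  canonical-off-cycles o {v} v∉ with classify v
  ... | inj₁ v∈      = ⊥-elim (v∉ v∈)
  ... | inj₂ (_ , p) = p , refl

  canonical-injective : ∀ o → Injective _≡_ _≡_ (canonical o)
  canonical-injective o {v} {w} with classify v | classify w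
  ... | inj₁ (inj₁ (i , refl)) | inj₁ (inj₁ (i′ , refl)) = cong C₁.vertex ∘ orient-injective (proj₁ o) ∘ C₁.esInj
  ... | inj₁ (inj₂ (j , refl)) | inj₁ (inj₂ (j′ , refl)) = cong C₂.vertex ∘ orient-injective (proj₂ o) ∘ C₂.esInj
  ... | inj₁ (inj₁ (i , _))    | inj₁ (inj₂ (j , _))     = ⊥-elim ∘ cycle-edges-disjoint _ _
  ... | inj₁ (inj₂ (j , _))    | inj₁ (inj₁ (i , _))     = ⊥-elim ∘ cycle-edges-disjoint _ _ ∘ sym
  ... | inj₁ (inj₁ (i , _))    | inj₂ (w∉ , q)           = λ eq → ⊥-elim (off-cycles-edge w∉ q (inj₁ (_ , eq)))
  ... | inj₁ (inj₂ (j , _))    | inj₂ (w∉ , q)           = λ eq → ⊥-elim (off-cycles-edge w∉ q (inj₂ (_ , eq)))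
  ... | inj₂ (v∉ , p)          | inj₁ (inj₁ (i , _))     = λ eq → ⊥-elim (off-cycles-edge v∉ p (inj₁ (_ , sym eq)))
  ... | inj₂ (v∉ , p)          | inj₁ (inj₂ (j , _))     = λ eq → ⊥-elim (off-cycles-edge v∉ p (inj₂ (_ , sym eq)))
  ... | inj₂ (_ , p)           | inj₂ (_ , q)            = parent-edge-injective p q

  module _ {τ : Fin 8 → Fin 8} (choice : Choice τ) where

    private
      τ-inj : Injective _≡_ _≡_ τ
      τ-inj = proj₁ choice
      τ-incident : ∀ v → Incident (τ v) v
      τ-incident = proj₂ choice

    -- For the canonical choice κ = canonical o₀, ψ = κ⁻¹ ∘ τ permutes the vertices and keeps
    -- the off-cycle ones off the cycles, since cycle edges have both ends on the cycles; so
    -- ψ also keeps the cycle vertices on them.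
    cycle-vertices-take-cycle-edges : ∀ {v} → OnCycles v → CycleEdge (τ v)
    cycle-vertices-take-cycle-edges {v} v∈ =
      subst CycleEdge (inverseˡ κ-inj (τ v))
        (canonical-cycle-edge o₀ (decidable-stable (onCycles? (ψ v)) ψv∈))
      where
      o₀ : Orientation
      o₀ = zero , zero
      κ-inj : Injective _≡_ _≡_ (canonical o₀)
      κ-inj = canonical-injective o₀
      ψ : Fin 8 → Fin 8
      ψ x = lookup (inverse κ-inj) (τ x)
      ψ-inj : Injective _≡_ _≡_ ψ
      ψ-inj eq = τ-inj (trans (sym (inverseˡ κ-inj _)) (trans (cong (canonical o₀) eq) (inverseˡ κ-inj _)))
      ψ-keeps-off : ∀ {x} → ¬ OnCycles x → ¬ OnCycles (ψ x)
      ψ-keeps-off {x} x∉ ψx∈ = x∉ (cycle-edge-ends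
        (subst CycleEdge (inverseˡ κ-inj (τ x)) (canonical-cycle-edge o₀ ψx∈)) (τ-incident x))
      ψv∈ : ¬ ¬ OnCycles (ψ v)
      ψv∈ ψv∉ = preserves⇒reflects ψ-inj (λ x → ¬ OnCycles x) ψ-keeps-off ψv∉ v∈

    C₁-takes-C₁-edges : ∀ i → ∃[ j ] C₁.es j ≡ τ (C₁.vertex i)
    C₁-takes-C₁-edges i = on-C₁ (cycle-vertices-take-cycle-edges {C₁.vertex i} (inj₁ (i , refl)))
      where
      on-C₁ : CycleEdge (τ (C₁.vertex i)) → ∃[ j ] C₁.es j ≡ τ (C₁.vertex i)
      on-C₁ (inj₁ found)    = found
      on-C₁ (inj₂ (j , eq)) =
        ⊥-elim (C₂-edge-misses-C₁ (subst (λ e → Incident e (C₁.vertex i)) (sym eq) (τ-incident _)))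

    C₂-takes-C₂-edges : ∀ j → ∃[ j′ ] C₂.es j′ ≡ τ (C₂.vertex j)
    C₂-takes-C₂-edges j = on-C₂ (cycle-vertices-take-cycle-edges {C₂.vertex j} (inj₂ (j , refl)))
      where
      on-C₂ : CycleEdge (τ (C₂.vertex j)) → ∃[ j′ ] C₂.es j′ ≡ τ (C₂.vertex j)
      on-C₂ (inj₁ (i , eq)) =
        ⊥-elim (C₁-edge-misses-C₂ (subst (λ e → Incident e (C₂.vertex j)) (sym eq) (τ-incident _)))
      on-C₂ (inj₂ found)    = found

    -- Some end of the parent edge e of v takes e, and it is not the parent: by induction
    -- the parent takes its own parent edge, or a cycle edge if it lies on a cycle.
    off-cycles-canonical : ∀ o {v} → Acc _<_ (depth v) → ¬ OnCycles v → τ v ≡ canonical o v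
    off-cycles-canonical o {v} (acc deeper) v∉ =
      taker-is-child (at-most-two-ends (labels e) v∈e w∈e (w≢v ∘ sym) z∈e)
      where
      p : Parent v
      p = proj₁ (canonical-off-cycles o v∉)
      open Parent p renaming ( edge to e; parent to w; incident-child to v∈e; incident-parent to w∈e
                             ; parent≢child to w≢v)
      κv≡e : canonical o v ≡ e
      κv≡e = proj₂ (canonical-off-cycles o v∉)
      z : Fin 8
      z = proj₁ (injective⇒surjective τ-inj e)
      τz≡e : τ z ≡ e
      τz≡e = proj₂ (injective⇒surjective τ-inj e)
      z∈e : Incident e z
      z∈e = subst (λ e′ → Incident e′ z) τz≡e (τ-incident z)
      parent-takes-other : τ w ≢ e
      parent-takes-other τw≡e = w≢v (canonical-injective o (begin
        canonical o w  ≡⟨ off-cycles-canonical o (deeper closer) w∉ ⟨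
        τ w            ≡⟨ τw≡e ⟩
        e              ≡⟨ κv≡e ⟨
        canonical o v  ∎))
        where
        open ≡-Reasoning
        w∉ : ¬ OnCycles w
        w∉ w∈ = off-cycles-edge v∉ p (subst CycleEdge τw≡e (cycle-vertices-take-cycle-edges w∈))
      taker-is-child : z ≡ v ⊎ z ≡ w → τ v ≡ canonical o v
      taker-is-child (inj₁ z≡v) = trans (subst (λ x → τ x ≡ e) z≡v τz≡e) (sym κv≡e)
      taker-is-child (inj₂ z≡w) = ⊥-elim (parent-takes-other (subst (λ x → τ x ≡ e) z≡w τz≡e))

    choice-canonical : ∃[ o ] ∀ v → τ v ≡ canonical o v
    choice-canonical = (s₁ , s₂) , agrees
      where
      C₁-orientation : ∃[ s ] ∀ i → τ (C₁.vertex i) ≡ C₁.es (orient s i)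
      C₁-orientation = C₁.choice-on-cycle choice C₁-takes-C₁-edges
      C₂-orientation : ∃[ s ] ∀ j → τ (C₂.vertex j) ≡ C₂.es (orient s j)
      C₂-orientation = C₂.choice-on-cycle choice C₂-takes-C₂-edges
      s₁ s₂ : Fin 2
      s₁ = proj₁ C₁-orientation
      s₂ = proj₁ C₂-orientation
      agrees-on : ∀ {v} → OnCycles v ⊎ ¬ OnCycles v → τ v ≡ canonical (s₁ , s₂) v
      agrees-on (inj₁ (inj₁ (i , refl))) = trans (proj₂ C₁-orientation i) (sym (canonical-C₁ (s₁ , s₂) i))
      agrees-on (inj₁ (inj₂ (j , refl))) = trans (proj₂ C₂-orientation j) (sym (canonical-C₂ (s₁ , s₂) j))
      agrees-on {v} (inj₂ v∉)            = off-cycles-canonical (s₁ , s₂) (<-wellFounded (depth v)) v∉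
      agrees : ∀ v → τ v ≡ canonical (s₁ , s₂) v
      agrees v = agrees-on (toSum (onCycles? v))

  solution : Orientation → Vec (Fin 8) 8
  solution o = inverse (canonical-injective o)

  solution-injective : ∀ {o o′} → solution o ≡ solution o′ → o ≡ o′
  solution-injective {s₁ , s₂} {s₁′ , s₂′} eq = cong₂ _,_
    (C₁.orient-determined (begin
      C₁.es (orient s₁ zero)              ≡⟨ canonical-C₁ (s₁ , s₂) zero ⟨
      canonical (s₁ , s₂) (C₁.vertex zero)   ≡⟨ agree (C₁.vertex zero) ⟩
      canonical (s₁′ , s₂′) (C₁.vertex zero) ≡⟨ canonical-C₁ (s₁′ , s₂′) zero ⟩
      C₁.es (orient s₁′ zero)             ∎))
    (C₂.orient-determined (begin
      C₂.es (orient s₂ zero)              ≡⟨ canonical-C₂ (s₁ , s₂) zero ⟨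
      canonical (s₁ , s₂) (C₂.vertex zero)   ≡⟨ agree (C₂.vertex zero) ⟩
      canonical (s₁′ , s₂′) (C₂.vertex zero) ≡⟨ canonical-C₂ (s₁′ , s₂′) zero ⟩
      C₂.es (orient s₂′ zero)             ∎))
    where
    open ≡-Reasoning
    agree : ∀ v → canonical (s₁ , s₂) v ≡ canonical (s₁′ , s₂′) v
    agree = inverse-injective (canonical-injective _) (canonical-injective _) eq

  solution-isSolution : ∀ o → IsSolution W (solution o)
  solution-isSolution o = choice⇒solution (canonical-injective o , canonical-incident o)


  solution-complete : ∀ σ → IsSolution W σ → ∃[ o ] solution o ≡ σ
  solution-complete σ σ-solution =
    o , sym (inverse-unique {τ = canonical o} (canonical-injective o) {σ} κσ≗id)
    where
    τ-data : ∃[ τ ] Choice τ × (∀ e → τ (lookup σ e) ≡ e)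
    τ-data = solution⇒choice σ σ-solution
    o-data : ∃[ o ] ∀ v → proj₁ τ-data v ≡ canonical o v
    o-data = choice-canonical {τ = proj₁ τ-data} (proj₁ (proj₂ τ-data))
    o : Orientation
    o = proj₁ o-data
    κσ≗id : ∀ e → canonical o (lookup σ e) ≡ e
    κσ≗id e = trans (sym (proj₂ o-data (lookup σ e))) (proj₂ (proj₂ τ-data) e)

  orientation : Fin 4 → Orientation
  orientation = remQuot 2

  orientation-injective : Injective _≡_ _≡_ orientation
  orientation-injective {i} {j} eq = begin
    i                                ≡⟨ combine-remQuot {2} 2 i ⟨
    uncurry combine (orientation i)  ≡⟨ cong (uncurry combine) eq ⟩
    uncurry combine (orientation j)  ≡⟨ combine-remQuot {2} 2 j ⟩
    j                                ∎
    where open ≡-Reasoning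

  orientation-surjective : ∀ o → ∃[ i ] orientation i ≡ o
  orientation-surjective (s₁ , s₂) = combine s₁ s₂ , remQuot-combine s₁ s₂

  solutions : SolutionNumber W 4
  solutions = count-image {P = IsSolution W} (solution ∘ orientation)
    (λ {i} {j} eq → orientation-injective (solution-injective {orientation i} {orientation j} eq))
    (λ i → solution-isSolution (orientation i))
    indexed-complete
    where
    indexed-complete : ∀ σ → IsSolution W σ → ∃[ i ] solution (orientation i) ≡ σ
    indexed-complete σ σ-solution =
      let o , solution-o≡σ = solution-complete σ σ-solution
          i , orientation-i≡o = orientation-surjective o
      in i , trans (cong solution orientation-i≡o) solution-o≡σ

-- The cycles are only given
-- doubly negated, but the solution count is found by exhaustive search, so it is stable.
lemma9 : (W : Family)
         → (∀ e → ValidColoring (W e))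
         → (∀ e e′ → SameCube (W e) (W e′) → e ≡ e′)
         → (∀ e → LabelsEdge (W e))
         → TwoComponents W
         → (∀ x → ¬ ComponentIsTree W x)
         → SolutionNumber W 4
lemma9 W _ _ labels (a , b , a≁b , cover) not-tree =
  count-stable (allVecs-unique 8 8) ∈-allVecs (Incidence.isSolution? W) λ ¬solutions →
    not-tree a λ (C₁ , C₁∼a) → not-tree b λ (C₂ , C₂∼b) →
      ¬solutions (TwoCycles.solutions W labels a b a≁b cover C₁ C₁∼a C₂ C₂∼b)
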